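{- Every dynamic rule $r$ of the form $p_1,\dots,p_n\;{:}{ - }\;\mathcal{A}(a_1,\dots,a_m)$ admits an equivalent automaton $A$ on assignments (reading assignments to $a_1,\dots,a_m$ and outputting assignments to $p_1,\dots,p_n$); i.e., for every interpretation $I$, time $t$ and $i\in[1,n]$, $(r,I,t)\models p_i$ if and only if $(A,I,t)\vdash p_i$.
   Context: Write $\mathbb{B}=\{0,1\}$. An operator automaton is $\mathcal{A}=\langle\mathbb{B}^m,[1,n],\delta,q_{\mathrm{init}}\rangle$ with $\delta:[1,n]\times\mathbb{B}^m\to[1,n]$, $q_{\mathrm{init}}\in[1,n]$. For the single-rule program $r$, the input variables are $a_1,\dots,a_m$ and an interpretation is a finite non-empty sequence $I=I_1,\dots,I_\ell$ of subsets of them; $(r,I,t)\models a_k$ iff $a_k\in I_t$; $(r,I,0)\models p_i$ iff $q_{\mathrm{init}}=i$; for $t>0$, $(r,I,t)\models p_i$ iff there are $j\in[1,n]$ and an assignment $\sigma\in\mathbb{B}^m$ to $(a_1,\dots,a_m)$ with $\delta(j,\sigma)=i$, $(r,I,t-1)\models p_j$ and $(r,I,t)\models\sigma$ (assignment identified with the conjunction of literals it makes true). An automaton is $\langle\Sigma,Q,\delta,q_{\mathrm{init}},\Gamma,\theta\rangle$ with $\delta:Q\times\Sigma\to Q$, $\theta:Q\times\Sigma\to\Gamma$; on $\sigma_1\dots\sigma_\ell$ its states are $q_0=q_{\mathrm{init}}$, $q_i=\delta(q_{i-1},\sigma_i)$, and upon reading $\sigma_i$ it outputs $\theta(q_{i-1},\sigma_i)$.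 An automaton on assignments has $\Sigma=\mathbb{B}^m$, $\Gamma=\mathbb{B}^k$ read as assignments to ordered input and output variables; strings over $\mathbb{B}^m$ are identified with interpretations; $(A,I,t)\vdash b$ iff the output upon reading the $t$-th letter assigns $1$ to $b$. -}

module Defs where

open import Data.Nat using (ℕ; zero; suc)
open import Data.Fin using (Fin)
open import Data.Fin.Subset using (Subset; _∈_)
open import Data.Bool using (Bool; true; false)
open import Data.Vec using (Vec; lookup)
open import Data.List using (List; []; _∷_)
open import Data.Maybe using (Maybe; just; nothing)
open import Data.Product using (Σ; _×_; ∃)
open import Relation.Binary.PropositionalEquality using (_≡_)
open import Relation.Nullary using (¬_)

-- 𝔹^m : assignments to (a_1,…,a_m); identified with subsets of {a_1,…,a_m}
-- (Subset m = Vec Bool m, entry k is true iff a_k is in the set / assigned 1).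
Assignment : ℕ → Set
Assignment m = Subset m

-- Operator automaton ⟨𝔹^m, [1,n], δ, q_init⟩; states [1,n] are Fin n.
record OpAutomaton (m n : ℕ) : Set where
  field
    δ     : Fin n → Assignment m → Fin n
    qinit : Fin n

-- 1-based access: xs at t is the t-th element I_t (nothing if t = 0 or t > length).
_at_ : {A : Set} → List A → ℕ → Maybe A
xs       at zero          = nothing
[]       at suc t         = nothing
(x ∷ xs) at suc zero      = just x
(x ∷ xs) at suc (suc t)   = xs at suc t

AtomHolds : {m : ℕ} → List (Subset m) → ℕ → Fin m → Set
AtomHolds I t k = ∃ λ S → (I at t ≡ just S) × (k ∈ S)

-- (r,I,t) ⊨ σ  (σ read as the conjunction of the literals it makes true)
SatAssign : {m : ℕ} → List (Subset m) → ℕ → Assignment m → Set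
SatAssign I t σ = ∀ k → (lookup σ k ≡ true → AtomHolds I t k)
                       × (lookup σ k ≡ false → ¬ AtomHolds I t k)

RuleHolds : {m n : ℕ} → OpAutomaton m n → List (Subset m) → ℕ → Fin n → Set
RuleHolds r I zero    i = OpAutomaton.qinit r ≡ i
RuleHolds r I (suc t) i =
  Σ (Fin _) λ j → Σ (Assignment _) λ σ →
    (OpAutomaton.δ r j σ ≡ i) × RuleHolds r I t j × SatAssign I (suc t) σ

record Automaton (Sig Γ : Set) : Set where
  field
    states : ℕ
    δ      : Fin states → Sig → Fin states
    qinit  : Fin states
    θ      : Fin states → Sig → Γ

-- output produced upon reading the t-th letter (1-based), starting in state q
outputFrom : {Sig Γ : Set} (A : Automaton Sig Γ) →
             Fin (Automaton.states A) → List Sig → ℕ → Maybe Γ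
outputFrom A q xs       zero          = nothing
outputFrom A q []       (suc t)       = nothing
outputFrom A q (x ∷ xs) (suc zero)    = just (Automaton.θ A q x)
outputFrom A q (x ∷ xs) (suc (suc t)) = outputFrom A (Automaton.δ A q x) xs (suc t)

outputAt : {Sig Γ : Set} (A : Automaton Sig Γ) → List Sig → ℕ → Maybe Γ
outputAt A = outputFrom A (Automaton.qinit A)

AssignAutomaton : ℕ → ℕ → Set
AssignAutomaton m k = Automaton (Assignment m) (Vec Bool k)

Derives : {m k : ℕ} → AssignAutomaton m k → List (Subset m) → ℕ → Fin k → Set
Derives A I t b = ∃ λ γ → (outputAt A I t ≡ just γ) × (lookup γ b ≡ true)

{-# OPTIONS --safe #-}
-- A rule holds at time t exactly for the state the operator automaton
-- reaches after the first t letters, since SatAssign I t σ pins σ down to I_t.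
-- The automaton on assignments therefore runs the same transition function
-- and, on reading σ in state q, outputs the singleton assignment ⁅ δ q σ ⁆.
module Submission where

open import Defs
open import Data.Nat using (ℕ; zero; suc; _≤_; s≤s)
open import Data.Nat.Properties using (<⇒≤)
open import Data.Fin using (Fin)
open import Data.Fin.Subset using (Subset; _∈_; ⁅_⁆)
open import Data.Fin.Subset.Properties using (⊆-antisym; x∈⁅y⁆⇔x≡y)
open import Data.Bool using (true; false)
open import Data.Bool.Properties using (not-¬)
open import Data.List.NonEmpty using (List⁺; toList)
open import Data.List using (List; []; _∷_; length)
open import Data.Maybe using (Maybe; just)
open import Data.Product using (Σ; ∃; _,_; _×_; proj₁; proj₂)
open import Data.Vec using (lookup)
open import Data.Vec.Properties using ([]=⇒lookup; lookup⇒[]=)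
open import Data.Empty using (⊥-elim)
open import Function.Bundles using (_⇔_; mk⇔; Equivalence)
import Function.Properties.Equivalence as ⇔
open import Relation.Binary.PropositionalEquality
  using (_≡_; refl; sym; trans; cong; cong₂; module ≡-Reasoning)
open import Level using (0ℓ)

open Equivalence using (to; from)

stateAfter : {Q Sig : Set} → (Q → Sig → Q) → Q → List Sig → ℕ → Q
stateAfter δ q xs       zero    = q
stateAfter δ q []       (suc t) = q
stateAfter δ q (x ∷ xs) (suc t) = stateAfter δ (δ q x) xs t

at-suc-defined : {A : Set} (xs : List A) (t : ℕ) →
                 suc t ≤ length xs → ∃ λ x → xs at suc t ≡ just x
at-suc-defined (x ∷ xs) zero    _          = x , refl
at-suc-defined (x ∷ xs) (suc t) (s≤s t<∣xs∣) = at-suc-defined xs t t<∣xs∣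

stateAfter-suc : {Q Sig : Set} (δ : Q → Sig → Q) (q : Q) (xs : List Sig) (t : ℕ) {x : Sig} →
                 xs at suc t ≡ just x → stateAfter δ q xs (suc t) ≡ δ (stateAfter δ q xs t) x
stateAfter-suc δ q (y ∷ xs) zero    refl = refl
stateAfter-suc δ q (y ∷ xs) (suc t) eq   = stateAfter-suc δ (δ q y) xs t eq

outputFrom-suc : {Sig Γ : Set} (A : Automaton Sig Γ) (q : Fin (Automaton.states A))
                 (xs : List Sig) (t : ℕ) {x : Sig} → xs at suc t ≡ just x →
                 outputFrom A q xs (suc t) ≡ just (Automaton.θ A (stateAfter (Automaton.δ A) q xs t) x)
outputFrom-suc A q (y ∷ xs) zero    refl = refl
outputFrom-suc A q (y ∷ xs) (suc t) eq   = outputFrom-suc A (Automaton.δ A q y) xs t eq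

∃-just⇔ : {A : Set} {P : A → Set} {mx : Maybe A} {x : A} →
          mx ≡ just x → (∃ λ y → (mx ≡ just y) × P y) ⇔ P x
∃-just⇔ refl = mk⇔ (λ { (y , refl , py) → py }) (λ px → _ , refl , px)

∈⇔lookup≡true : {m : ℕ} (p : Subset m) (k : Fin m) → k ∈ p ⇔ lookup p k ≡ true
∈⇔lookup≡true p k = mk⇔ []=⇒lookup (lookup⇒[]= k p)

module _ {m : ℕ} (I : List (Subset m)) (t : ℕ) {S : Subset m} (I-at-t : I at t ≡ just S) where

  atomHolds⇔∈ : (k : Fin m) → AtomHolds I t k ⇔ k ∈ S
  atomHolds⇔∈ k = ∃-just⇔ {P = k ∈_} I-at-t

  satAssign⇔≡ : (σ : Subset m) → SatAssign I t σ ⇔ σ ≡ S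
  satAssign⇔≡ σ = mk⇔ (λ sat → ⊆-antisym (σ⊆S sat) (S⊆σ sat)) satisfies-S
    where
    σ⊆S : SatAssign I t σ → ∀ {k} → k ∈ σ → k ∈ S
    σ⊆S sat {k} k∈σ = to (atomHolds⇔∈ k) (proj₁ (sat k) ([]=⇒lookup k∈σ))

    S⊆σ : SatAssign I t σ → ∀ {k} → k ∈ S → k ∈ σ
    S⊆σ sat {k} k∈S with lookup σ k in σk
    ... | true  = lookup⇒[]= k σ σk
    ... | false = ⊥-elim (proj₂ (sat k) σk (from (atomHolds⇔∈ k) k∈S))

    satisfies-S : σ ≡ S → SatAssign I t σ
    satisfies-S refl k = (λ Sk → from (atomHolds⇔∈ k) (lookup⇒[]= k S Sk))
                       , (λ Sk atom → not-¬ Sk ([]=⇒lookup (to (atomHolds⇔∈ k) atom)))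

module _ {m n : ℕ} (r : OpAutomaton m n) where
  open OpAutomaton r

  ruleHolds⇔stateAfter : (I : List (Subset m)) (t : ℕ) → t ≤ length I → (i : Fin n) →
                         RuleHolds r I t i ⇔ stateAfter δ qinit I t ≡ i
  ruleHolds⇔stateAfter I zero    _     i = ⇔.refl
  ruleHolds⇔stateAfter I (suc t) t<∣I∣ i = mk⇔ reaches holds
    where
    S : Subset m
    S = proj₁ (at-suc-defined I t t<∣I∣)

    I-at-t : I at suc t ≡ just S
    I-at-t = proj₂ (at-suc-defined I t t<∣I∣)

    ih : (j : Fin n) → RuleHolds r I t j ⇔ stateAfter δ qinit I t ≡ j
    ih = ruleHolds⇔stateAfter I t (<⇒≤ t<∣I∣)

    reaches : RuleHolds r I (suc t) i → stateAfter δ qinit I (suc t) ≡ i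
    reaches (j , σ , δjσ≡i , holds-j , sat) = begin
      stateAfter δ qinit I (suc t) ≡⟨ stateAfter-suc δ qinit I t I-at-t ⟩
      δ (stateAfter δ qinit I t) S ≡⟨ cong₂ δ (to (ih j) holds-j)
                                              (sym (to (satAssign⇔≡ I (suc t) I-at-t σ) sat)) ⟩
      δ j σ                        ≡⟨ δjσ≡i ⟩
      i                            ∎
      where open ≡-Reasoning

    holds : stateAfter δ qinit I (suc t) ≡ i → RuleHolds r I (suc t) i
    holds reached = stateAfter δ qinit I t , S
                  , trans (sym (stateAfter-suc δ qinit I t I-at-t)) reached
                  , from (ih _) refl
                  , from (satAssign⇔≡ I (suc t) I-at-t S) refl

  singletonAutomaton : AssignAutomaton m n
  singletonAutomaton = record
    { states = n ; δ = δ ; qinit = qinit ; θ = λ q σ → ⁅ δ q σ ⁆ }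

  derives⇔stateAfter : (I : List (Subset m)) (t : ℕ) {S : Subset m} → I at suc t ≡ just S →
                       (i : Fin n) →
                       Derives singletonAutomaton I (suc t) i ⇔ stateAfter δ qinit I (suc t) ≡ i
  derives⇔stateAfter I t {S} I-at-t i = begin
    Derives singletonAutomaton I (suc t) i ≈⟨ ∃-just⇔ (outputFrom-suc singletonAutomaton qinit I t I-at-t) ⟩
    lookup ⁅ q′ ⁆ i ≡ true                 ≈⟨ ⇔.sym (∈⇔lookup≡true ⁅ q′ ⁆ i) ⟩
    i ∈ ⁅ q′ ⁆                             ≈⟨ x∈⁅y⁆⇔x≡y ⟩
    i ≡ q′                                 ≈⟨ mk⇔ sym sym ⟩
    q′ ≡ i                                 ≡⟨ cong (_≡ i) (stateAfter-suc δ qinit I t I-at-t) ⟨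
    stateAfter δ qinit I (suc t) ≡ i       ∎
    where
    q′ : Fin n
    q′ = δ (stateAfter δ qinit I t) S
    open import Relation.Binary.Reasoning.Setoid (⇔.⇔-setoid 0ℓ)

lemma2 : ∀ {m n : ℕ} (r : OpAutomaton m n) →
    Σ (AssignAutomaton m n) λ A →
      ∀ (I : List⁺ (Subset m)) (t : ℕ) → 1 ≤ t → t ≤ length (toList I) →
      ∀ (i : Fin n) → RuleHolds r (toList I) t i ⇔ Derives A (toList I) t i
lemma2 r = singletonAutomaton r , equivalent
  where
  equivalent : ∀ I t → 1 ≤ t → t ≤ length (toList I) → ∀ i →
               RuleHolds r (toList I) t i ⇔ Derives (singletonAutomaton r) (toList I) t i
  equivalent I (suc t) _ t<∣I∣ i with at-suc-defined (toList I) t t<∣I∣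
  ... | _ , I-at-t = ⇔.trans (ruleHolds⇔stateAfter r (toList I) (suc t) t<∣I∣ i)
                             (⇔.sym (derives⇔stateAfter r (toList I) t I-at-t i))
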